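{- Let $a>1$ be an odd integer and let $N=a^2+4$. Then each of the two real numbers $\frac{\sqrt{N}+1}{4}$ and $\frac{\sqrt{N}-1}{4}$ is equivalent to $\sqrt{N}$.
   Context: Two irrational real numbers $x,y$ are called equivalent if $y=\frac{px+q}{rx+s}$ for some integers $p,q,r,s$ with $ps-qr=\pm1$; equivalently, their simple continued fraction expansions eventually coincide (for quadratic irrationals: their periodic parts are equal). -}

module Defs where

open import Data.Nat as ℕ using (ℕ)
open import Data.Integer as ℤ using (ℤ; +_; -[1+_])
open import Data.Rational as ℚ using (ℚ; _/_)
open import Data.Product using (∃-syntax; _×_)
open import Data.Sum using (_⊎_)
open import Relation.Binary.PropositionalEquality using (_≡_)

-- The quadratic field ℚ(√N), for a fixed natural N (non-square in our use):
-- an element  re + im·√N  is stored as its pair of rational coordinates.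
-- For non-square N, (re, im) ↦ re + im·√N is an injective ring map into ℝ,
-- so equality of pairs is exactly equality of the corresponding reals.
record QF (N : ℕ) : Set where
  constructor ⟨_,_⟩
  field
    re : ℚ
    im : ℚ
open QF public

module _ {N : ℕ} where
  infixl 6 _⊕_
  infixl 7 _⊗_
  _⊕_ : QF N → QF N → QF N
  ⟨ a , b ⟩ ⊕ ⟨ c , d ⟩ = ⟨ a ℚ.+ c , b ℚ.+ d ⟩

  _⊗_ : QF N → QF N → QF N
  ⟨ a , b ⟩ ⊗ ⟨ c , d ⟩ =
    ⟨ a ℚ.* c ℚ.+ (ℤ.+ N / 1) ℚ.* b ℚ.* d , a ℚ.* d ℚ.+ b ℚ.* c ⟩

  ι : ℤ → QF N
  ι k = ⟨ k / 1 , ℚ.0ℚ ⟩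

√ : (N : ℕ) → QF N
√ N = ⟨ ℚ.0ℚ , ℚ.1ℚ ⟩

-- Equivalence of (irrational) numbers: y = (p x + q)/(r x + s) with
-- integers p q r s, p s − q r = ±1.  Stated in cleared-denominator form
-- y·(r x + s) = p x + q; for irrational x the denominator r x + s is
-- automatically nonzero (r, s are not both 0 since ps − qr = ±1).
Equivalent : {N : ℕ} → QF N → QF N → Set
Equivalent x y =
  ∃[ p ] ∃[ q ] ∃[ r ] ∃[ s ]
    ((p ℤ.* s ℤ.- q ℤ.* r ≡ ℤ.1ℤ ⊎ p ℤ.* s ℤ.- q ℤ.* r ≡ ℤ.-1ℤ) ×
     (y ⊗ (ι r ⊗ x ⊕ ι s) ≡ ι p ⊗ x ⊕ ι q))

-- If u = 1/d and the integers r, s satisfy N r² − s² = d, then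
-- (ε + √N) u · (r √N + s) = ((ε s + r N) + (ε r + s) √N) u, and the matrix with rows
-- ((ε r + s)/d, (ε s + r N)/d) and (r, s) has determinant (s² − N r²)/d = −1 as soon as
-- its entries are integers.  For N = a² + 4, d = 4 and s = a this happens with r = ±1,
-- the sign of r fixed by ε and a mod 4.
module Submission where

open import Defs
open import Data.Nat using (ℕ; _*_; _+_; _<_)
open import Data.Nat.DivMod using (_%_)
open import Relation.Binary.PropositionalEquality using (_≡_)
open import Data.Product using (_×_)
open import Data.Integer using (+_)
open import Data.Rational using (_/_; -_)

open import Level using (0ℓ)
open import Data.Nat using (suc)
open import Data.List using (_∷_; [])
open import Data.Product using (_,_; ∃-syntax)
open import Data.Sum using (_⊎_; inj₁; inj₂)
open import Data.Integer as ℤ using (ℤ)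
import Data.Integer.Properties as ℤ
import Data.Integer.Tactic.RingSolver as ℤ-Solver
open import Data.Rational as ℚ using (ℚ; 0ℚ; 1ℚ; toℚᵘ)
open import Data.Rational.Properties as ℚ using (toℚᵘ-injective; toℚᵘ-fromℚᵘ; toℚᵘ-homo-+; toℚᵘ-homo-*)
open import Data.Rational.Unnormalised as ℚᵘ using (mkℚᵘ; *≡*)
import Data.Rational.Unnormalised.Properties as ℚᵘ
open import Relation.Binary.PropositionalEquality using (refl; sym; trans; cong; cong₂; module ≡-Reasoning)
open import Relation.Nullary.Decidable using (dec⇒maybe)
open import Tactic.RingSolver using (solve-∀)
open import Tactic.RingSolver.Core.AlmostCommutativeRing using (AlmostCommutativeRing; fromCommutativeRing)

ℚ-ring : AlmostCommutativeRing 0ℓ 0ℓ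
ℚ-ring = fromCommutativeRing ℚ.+-*-commutativeRing (λ x → dec⇒maybe (0ℚ ℚ.≟ x))

fromℤ : ℤ → ℚ
fromℤ k = k / 1

toℚᵘ-fromℤ : ∀ k → toℚᵘ (fromℤ k) ℚᵘ.≃ mkℚᵘ k 0
toℚᵘ-fromℤ k = toℚᵘ-fromℚᵘ (mkℚᵘ k 0)

fromℤ-homo-+ : ∀ i j → fromℤ (i ℤ.+ j) ≡ fromℤ i ℚ.+ fromℤ j
fromℤ-homo-+ i j = toℚᵘ-injective (begin
  toℚᵘ (fromℤ (i ℤ.+ j))              ≈⟨ toℚᵘ-fromℤ (i ℤ.+ j) ⟩
  mkℚᵘ (i ℤ.+ j) 0                    ≈⟨ *≡* (numerators i j) ⟩
  mkℚᵘ i 0 ℚᵘ.+ mkℚᵘ j 0              ≈⟨ ℚᵘ.+-cong (toℚᵘ-fromℤ i) (toℚᵘ-fromℤ j) ⟨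
  toℚᵘ (fromℤ i) ℚᵘ.+ toℚᵘ (fromℤ j)  ≈⟨ toℚᵘ-homo-+ (fromℤ i) (fromℤ j) ⟨
  toℚᵘ (fromℤ i ℚ.+ fromℤ j)          ∎)
  where
  open ℚᵘ.≃-Reasoning
  numerators : ∀ i j → (i ℤ.+ j) ℤ.* + 1 ≡ (i ℤ.* + 1 ℤ.+ j ℤ.* + 1) ℤ.* + 1
  numerators = solve-∀ ℤ-Solver.ring

fromℤ-homo-* : ∀ i j → fromℤ (i ℤ.* j) ≡ fromℤ i ℚ.* fromℤ j
fromℤ-homo-* i j = toℚᵘ-injective (begin
  toℚᵘ (fromℤ (i ℤ.* j))              ≈⟨ toℚᵘ-fromℤ (i ℤ.* j) ⟩
  mkℚᵘ (i ℤ.* j) 0                    ≈⟨ ℚᵘ.*-cong (toℚᵘ-fromℤ i) (toℚᵘ-fromℤ j) ⟨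
  toℚᵘ (fromℤ i) ℚᵘ.* toℚᵘ (fromℤ j)  ≈⟨ toℚᵘ-homo-* (fromℤ i) (fromℤ j) ⟨
  toℚᵘ (fromℤ i ℚ.* fromℤ j)          ∎)
  where open ℚᵘ.≃-Reasoning

fromℤ-quotient : ∀ d x y {u} → fromℤ d ℚ.* u ≡ 1ℚ → d ℤ.* x ≡ y → fromℤ x ≡ fromℤ y ℚ.* u
fromℤ-quotient d x y {u} du≡1 dx≡y = begin
  fromℤ x                          ≡⟨ ℚ.*-identityʳ (fromℤ x) ⟨
  fromℤ x ℚ.* 1ℚ                   ≡⟨ cong (fromℤ x ℚ.*_) du≡1 ⟨
  fromℤ x ℚ.* (fromℤ d ℚ.* u)      ≡⟨ reassociate (fromℤ x) (fromℤ d) u ⟩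
  (fromℤ d ℚ.* fromℤ x) ℚ.* u      ≡⟨ cong (ℚ._* u) (fromℤ-homo-* d x) ⟨
  fromℤ (d ℤ.* x) ℚ.* u            ≡⟨ cong (λ z → fromℤ z ℚ.* u) dx≡y ⟩
  fromℤ y ℚ.* u                    ∎
  where
  open ≡-Reasoning
  reassociate : ∀ x d u → x ℚ.* (d ℚ.* u) ≡ (d ℚ.* x) ℚ.* u
  reassociate = solve-∀ ℚ-ring

module _ {N : ℕ} where

  ι⊗√⊕ι : ∀ r s → ι r ⊗ √ N ⊕ ι s ≡ ⟨ fromℤ s , fromℤ r ⟩
  ι⊗√⊕ι r s = cong₂ ⟨_,_⟩ (rational-part (fromℤ r) (+ N / 1) (fromℤ s)) (surd-part (fromℤ r))
    where
    rational-part : ∀ x n y → x ℚ.* 0ℚ ℚ.+ n ℚ.* 0ℚ ℚ.* 1ℚ ℚ.+ y ≡ y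
    rational-part = solve-∀ ℚ-ring
    surd-part : ∀ x → x ℚ.* 1ℚ ℚ.+ 0ℚ ℚ.* 0ℚ ℚ.+ 0ℚ ≡ x
    surd-part = solve-∀ ℚ-ring

  √-equivalent-[ε+√]/d : ∀ (u : ℚ) (d ε r s p q : ℤ) .{{_ : ℤ.NonZero d}} →
    fromℤ d ℚ.* u ≡ 1ℚ →
    r ℤ.* r ℤ.* + N ≡ s ℤ.* s ℤ.+ d →
    d ℤ.* p ≡ ε ℤ.* r ℤ.+ s →
    d ℤ.* q ≡ ε ℤ.* s ℤ.+ r ℤ.* + N →
    Equivalent (√ N) ⟨ fromℤ ε ℚ.* u , u ⟩
  √-equivalent-[ε+√]/d u d ε r s p q du≡1 pell dp dq =
    p , q , r , s , inj₂ determinant , (begin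
      y ⊗ (ι r ⊗ √ N ⊕ ι s)   ≡⟨ cong (y ⊗_) (ι⊗√⊕ι r s) ⟩
      y ⊗ ⟨ S , R ⟩           ≡⟨ cong₂ ⟨_,_⟩ rational-part surd-part ⟩
      ⟨ fromℤ q , fromℤ p ⟩   ≡⟨ ι⊗√⊕ι p q ⟨
      ι p ⊗ √ N ⊕ ι q         ∎)
    where
    open ≡-Reasoning
    E R S n : ℚ
    E = fromℤ ε
    R = fromℤ r
    S = fromℤ s
    n = fromℤ (+ N)
    y : QF N
    y = ⟨ E ℚ.* u , u ⟩

    rational-part : E ℚ.* u ℚ.* S ℚ.+ n ℚ.* u ℚ.* R ≡ fromℤ q
    rational-part = begin
      E ℚ.* u ℚ.* S ℚ.+ n ℚ.* u ℚ.* R      ≡⟨ factor E u S n R ⟩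
      (E ℚ.* S ℚ.+ R ℚ.* n) ℚ.* u          ≡⟨ cong (ℚ._* u) (sym homo) ⟩
      fromℤ (ε ℤ.* s ℤ.+ r ℤ.* + N) ℚ.* u  ≡⟨ fromℤ-quotient d q _ du≡1 dq ⟨
      fromℤ q                              ∎
      where
      factor : ∀ e u s n r → e ℚ.* u ℚ.* s ℚ.+ n ℚ.* u ℚ.* r ≡ (e ℚ.* s ℚ.+ r ℚ.* n) ℚ.* u
      factor = solve-∀ ℚ-ring
      homo : fromℤ (ε ℤ.* s ℤ.+ r ℤ.* + N) ≡ E ℚ.* S ℚ.+ R ℚ.* n
      homo = trans (fromℤ-homo-+ (ε ℤ.* s) (r ℤ.* + N))
                   (cong₂ ℚ._+_ (fromℤ-homo-* ε s) (fromℤ-homo-* r (+ N)))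

    surd-part : E ℚ.* u ℚ.* R ℚ.+ u ℚ.* S ≡ fromℤ p
    surd-part = begin
      E ℚ.* u ℚ.* R ℚ.+ u ℚ.* S        ≡⟨ factor E u R S ⟩
      (E ℚ.* R ℚ.+ S) ℚ.* u            ≡⟨ cong (ℚ._* u) (sym homo) ⟩
      fromℤ (ε ℤ.* r ℤ.+ s) ℚ.* u      ≡⟨ fromℤ-quotient d p _ du≡1 dp ⟨
      fromℤ p                          ∎
      where
      factor : ∀ e u r s → e ℚ.* u ℚ.* r ℚ.+ u ℚ.* s ≡ (e ℚ.* r ℚ.+ s) ℚ.* u
      factor = solve-∀ ℚ-ring
      homo : fromℤ (ε ℤ.* r ℤ.+ s) ≡ E ℚ.* R ℚ.+ S
      homo = trans (fromℤ-homo-+ (ε ℤ.* r) s) (cong (ℚ._+ S) (fromℤ-homo-* ε r))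

    determinant : p ℤ.* s ℤ.- q ℤ.* r ≡ ℤ.-1ℤ
    determinant = ℤ.*-cancelˡ-≡ d _ _ (begin
      d ℤ.* (p ℤ.* s ℤ.- q ℤ.* r)                              ≡⟨ expand d p s q r ⟩
      d ℤ.* p ℤ.* s ℤ.- d ℤ.* q ℤ.* r                          ≡⟨ cong₂ (λ x z → x ℤ.* s ℤ.- z ℤ.* r) dp dq ⟩
      (ε ℤ.* r ℤ.+ s) ℤ.* s ℤ.- (ε ℤ.* s ℤ.+ r ℤ.* + N) ℤ.* r  ≡⟨ cancel ε r s (+ N) ⟩
      s ℤ.* s ℤ.- r ℤ.* r ℤ.* + N                              ≡⟨ cong (λ t → s ℤ.* s ℤ.- t) pell ⟩
      s ℤ.* s ℤ.- (s ℤ.* s ℤ.+ d)                              ≡⟨ simplify s d ⟩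
      d ℤ.* ℤ.-1ℤ                                              ∎)
      where
      expand : ∀ d p s q r → d ℤ.* (p ℤ.* s ℤ.- q ℤ.* r) ≡ d ℤ.* p ℤ.* s ℤ.- d ℤ.* q ℤ.* r
      expand = solve-∀ ℤ-Solver.ring
      cancel : ∀ ε r s n → (ε ℤ.* r ℤ.+ s) ℤ.* s ℤ.- (ε ℤ.* s ℤ.+ r ℤ.* n) ℤ.* r ≡ s ℤ.* s ℤ.- r ℤ.* r ℤ.* n
      cancel = solve-∀ ℤ-Solver.ring
      simplify : ∀ s d → s ℤ.* s ℤ.- (s ℤ.* s ℤ.+ d) ≡ d ℤ.* ℤ.-1ℤ
      simplify = solve-∀ ℤ-Solver.ring

√[a²+4]-equivalent : ∀ {a : ℕ} {A : ℤ} → + a ≡ A → ∀ (ε r p q : ℤ) → r ℤ.* r ≡ ℤ.1ℤ →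
  + 4 ℤ.* p ≡ ε ℤ.* r ℤ.+ A →
  + 4 ℤ.* q ≡ ε ℤ.* A ℤ.+ r ℤ.* (A ℤ.* A ℤ.+ + 4) →
  Equivalent (√ (a * a + 4)) ⟨ fromℤ ε ℚ.* (+ 1 / 4) , + 1 / 4 ⟩
√[a²+4]-equivalent {a} refl ε r p q r²≡1 4p≡ 4q≡ =
  √-equivalent-[ε+√]/d (+ 1 / 4) (+ 4) ε r (+ a) p q refl pell 4p≡
    (trans 4q≡ (cong (λ n → ε ℤ.* + a ℤ.+ r ℤ.* n) (sym N≡)))
  where
  N≡ : + (a * a + 4) ≡ + a ℤ.* + a ℤ.+ + 4
  N≡ = trans (ℤ.pos-+ (a * a) 4) (cong (ℤ._+ + 4) (ℤ.pos-* a a))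
  pell : r ℤ.* r ℤ.* + (a * a + 4) ≡ + a ℤ.* + a ℤ.+ + 4
  pell = trans (cong (ℤ._* + (a * a + 4)) r²≡1) (trans (ℤ.*-identityˡ _) N≡)

equivalent-1-mod-4 : ∀ {a} (k : ℤ) → + a ≡ + 1 ℤ.+ k ℤ.* + 4 →
  Equivalent (√ (a * a + 4)) ⟨ + 1 / 4 , + 1 / 4 ⟩ ×
  Equivalent (√ (a * a + 4)) ⟨ - (+ 1 / 4) , + 1 / 4 ⟩
equivalent-1-mod-4 k a≡ =
  √[a²+4]-equivalent a≡ (+ 1) ℤ.-1ℤ k (ℤ.- (+ 4 ℤ.* k ℤ.* k ℤ.+ k ℤ.+ + 1)) refl
    (ℤ-Solver.solve (k ∷ [])) (ℤ-Solver.solve (k ∷ [])) ,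
  √[a²+4]-equivalent a≡ ℤ.-1ℤ (+ 1) k (+ 4 ℤ.* k ℤ.* k ℤ.+ k ℤ.+ + 1) refl
    (ℤ-Solver.solve (k ∷ [])) (ℤ-Solver.solve (k ∷ []))

equivalent-3-mod-4 : ∀ {a} (k : ℤ) → + a ≡ + 3 ℤ.+ k ℤ.* + 4 →
  Equivalent (√ (a * a + 4)) ⟨ + 1 / 4 , + 1 / 4 ⟩ ×
  Equivalent (√ (a * a + 4)) ⟨ - (+ 1 / 4) , + 1 / 4 ⟩
equivalent-3-mod-4 k a≡ =
  √[a²+4]-equivalent a≡ (+ 1) (+ 1) (k ℤ.+ + 1) (+ 4 ℤ.* k ℤ.* k ℤ.+ + 7 ℤ.* k ℤ.+ + 4) refl
    (ℤ-Solver.solve (k ∷ [])) (ℤ-Solver.solve (k ∷ [])) ,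
  √[a²+4]-equivalent a≡ ℤ.-1ℤ ℤ.-1ℤ (k ℤ.+ + 1) (ℤ.- (+ 4 ℤ.* k ℤ.* k ℤ.+ + 7 ℤ.* k ℤ.+ + 4)) refl
    (ℤ-Solver.solve (k ∷ [])) (ℤ-Solver.solve (k ∷ []))

-- (4 + a) % 2 reduces to a % 2, so the parity hypothesis is passed on unchanged.
odd⇒1∨3-mod-4 : ∀ a → a % 2 ≡ 1 → ∃[ k ] (a ≡ 1 + k * 4 ⊎ a ≡ 3 + k * 4)
odd⇒1∨3-mod-4 1 _ = 0 , inj₁ refl
odd⇒1∨3-mod-4 3 _ = 0 , inj₂ refl
odd⇒1∨3-mod-4 (suc (suc (suc (suc a)))) a-odd with odd⇒1∨3-mod-4 a a-odd
... | k , inj₁ refl = suc k , inj₁ refl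
... | k , inj₂ refl = suc k , inj₂ refl

+[c+k*4] : ∀ c k → + (c + k * 4) ≡ + c ℤ.+ + k ℤ.* + 4
+[c+k*4] c k = trans (ℤ.pos-+ c (k * 4)) (cong (λ t → + c ℤ.+ t) (ℤ.pos-* k 4))

mainTheorem1 : (a : ℕ) → 1 < a → a % 2 ≡ 1 →
    Equivalent {a * a + 4} (√ (a * a + 4)) ⟨ + 1 / 4 , + 1 / 4 ⟩ ×
    Equivalent {a * a + 4} (√ (a * a + 4)) ⟨ - (+ 1 / 4) , + 1 / 4 ⟩
mainTheorem1 a _ a-odd with odd⇒1∨3-mod-4 a a-odd
... | k , inj₁ refl = equivalent-1-mod-4 (+ k) (+[c+k*4] 1 k)
... | k , inj₂ refl = equivalent-3-mod-4 (+ k) (+[c+k*4] 3 k)
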